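{- $\mathrm{ex}(n,C_4,\textup{rainbow- }C_4)=\Omega(n^{3/2})$ as $n\to\infty$, where $C_4$ is the cycle on $4$ vertices.
   Context: An edge-coloring is proper if any two edges sharing a vertex receive different colors. A subgraph of an edge-colored graph is rainbow if all its edges have distinct colors. For graphs $H$ and $F$, $\mathrm{ex}(n,H,\textup{rainbow- }F)$ denotes the maximum number of copies of $H$ (subgraphs isomorphic to $H$) in a graph $G$ on $n$ vertices equipped with a proper edge-coloring in which there is no rainbow copy of $F$. -}

module Defs where

open import Data.Nat using (ℕ; _/_)
open import Data.Bool using (Bool; true; false; _∧_; not)
open import Data.Fin using (Fin; _≟_)
open import Data.List using (List; length; filterᵇ; allFin; concatMap; map)
open import Data.Product using (_×_; _,_; Σ)
open import Relation.Nullary using (¬_)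
open import Relation.Nullary.Decidable using (⌊_⌋)
open import Relation.Binary.PropositionalEquality using (_≡_; _≢_)

record Graph (n : ℕ) : Set where
  field
    adj    : Fin n → Fin n → Bool
    adj-sym : ∀ u v → adj u v ≡ adj v u
    adj-irrefl : ∀ v → adj v v ≡ false
open Graph public

Edge : ∀ {n} → Graph n → Fin n → Fin n → Set
Edge G u v = adj G u v ≡ true

-- An edge-colouring: a colour (natural number) for each vertex pair;
-- only values on edges matter, and it must not depend on orientation.
Colouring : ℕ → Set
Colouring n = Fin n → Fin n → ℕ

IsEdgeColouring : ∀ {n} → Graph n → Colouring n → Set
IsEdgeColouring G c = ∀ u v → Edge G u v → c u v ≡ c v u

IsProper : ∀ {n} → Graph n → Colouring n → Set
IsProper G c = ∀ u v w → Edge G u v → Edge G u w → v ≢ w → c u v ≢ c u w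

_≠ᵇ_ : ∀ {n} → Fin n → Fin n → Bool
a ≠ᵇ b = not ⌊ a ≟ b ⌋

Is4Cycle : ∀ {n} → Graph n → Fin n → Fin n → Fin n → Fin n → Bool
Is4Cycle G a b c d =
  (a ≠ᵇ b) ∧ (a ≠ᵇ c) ∧ (a ≠ᵇ d) ∧ (b ≠ᵇ c) ∧ (b ≠ᵇ d) ∧ (c ≠ᵇ d) ∧
  adj G a b ∧ adj G b c ∧ adj G c d ∧ adj G d a

Quad : ℕ → Set
Quad n = Fin n × Fin n × Fin n × Fin n

allQuads : ∀ n → List (Quad n)
allQuads n =
  concatMap (λ a → concatMap (λ b → concatMap (λ c →
    map (λ d → (a , b , c , d)) (allFin n)) (allFin n)) (allFin n)) (allFin n)

cycleTuples : ∀ {n} → Graph n → ℕ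
cycleTuples {n} G = length (filterᵇ (λ { (a , b , c , d) → Is4Cycle G a b c d }) (allQuads n))

-- Number of copies of C4 (subgraphs isomorphic to C4): each copy
-- corresponds to exactly 8 ordered tuples (4 starting points × 2 directions).
numC4 : ∀ {n} → Graph n → ℕ
numC4 G = cycleTuples G / 8

RainbowC4 : ∀ {n} → Graph n → Colouring n → Set
RainbowC4 {n} G col =
  Σ (Fin n) λ a → Σ (Fin n) λ b → Σ (Fin n) λ c → Σ (Fin n) λ d →
    (Is4Cycle G a b c d ≡ true) ×
    (col a b ≢ col b c) × (col a b ≢ col c d) × (col a b ≢ col d a) ×
    (col b c ≢ col c d) × (col b c ≢ col d a) × (col c d ≢ col d a)

GoodColoured : ∀ {n} → Graph n → Colouring n → Set
GoodColoured G col = IsEdgeColouring G col × IsProper G col × ¬ RainbowC4 G col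

-- The construction is a Cayley graph of 𝔽₂ᵗ.  Take S ⊆ 𝔽₂ᵗ ∖ {0} with no four distinct
-- members summing to 0 (a Sidon set), join x and y when x + y ∈ S, and colour that edge
-- by x + y.  The colouring is proper, and the four colours around a 4-cycle sum to 0, so
-- they are never pairwise distinct.  Every x and ordered pair s₁ ≠ s₂ in S give the
-- 4-cycle x, x + s₁, x + s₁ + s₂, x + s₂, so there are at least 2ᵗ|S|(|S| - 1) ordered
-- 4-cycles.  Greedily, |S| = a is possible as soon as a³ < 2ᵗ; with 2ᵗ = a⁴ ≤ n < 16a⁴
-- (the other vertices isolated) this gives about a⁶, i.e. order n^{3/2}, copies of C₄.
module Submission where

open import Defs
open import Algebra.Properties.CommutativeSemigroup using (interchange)
open import Data.Bool using (Bool; true; false; _∧_; _∨_; not; _xor_)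
import Data.Bool.Properties as Bool
open import Data.Fin using (Fin; zero; suc; toℕ; combine; remQuot; inject≤; _↑ˡ_; _↑ʳ_)
import Data.Fin as Fin
import Data.Fin.Properties as Fin
open import Data.List using (List; []; _∷_; _++_; length; filterᵇ; concatMap; map; tabulate; allFin; cartesianProductWith; lookup)
open import Data.List.Properties using (filter-++; length-++; length-map)
open import Data.List.Membership.Propositional using (_∈_; _∉_)
open import Data.List.Membership.Propositional.Properties using (∈-cartesianProductWith⁺)
import Data.List.Membership.DecPropositional as DecMembership
open import Data.List.Relation.Unary.Any using (here; there; index)
open import Data.List.Relation.Unary.Any.Properties using (lookup-index)
open import Data.List.Relation.Unary.All.Properties using (All¬⇒¬Any; ¬Any⇒All¬)
open import Data.List.Relation.Unary.AllPairs using ([]; _∷_)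
open import Data.List.Relation.Unary.Unique.Propositional using (Unique)
open import Data.Nat using (ℕ; zero; suc; _+_; _*_; _^_; _∸_; _/_; _%_; _≤_; _<_; z≤n; s≤s; s≤s⁻¹; z<s; _<?_; NonZero)
open import Data.Nat.DivMod using (_mod_; m<n⇒m%n≡m; m≡m%n+[m/n]*n; m%n<n)
open import Data.Nat.Properties hiding (_≟_)
open import Data.Nat.Solver using (module +-*-Solver)
open import Data.Product using (Σ; Σ-syntax; ∃; ∃-syntax; _×_; _,_; proj₁; proj₂)
open import Data.Vec using (Vec; []; _∷_; zipWith; replicate)
open import Data.Vec.Properties using (≡-dec; zipWith-comm; zipWith-assoc; zipWith-identityˡ; zipWith-identityʳ)
open import Function using (_∘_; id; Inverse)
open import Relation.Binary.Definitions using (DecidableEquality)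
open import Relation.Binary.PropositionalEquality
open import Relation.Nullary using (¬_; Dec; does; yes; no; contradiction)
open import Relation.Nullary.Decidable using (dec-true; dec-false; isYes≗does)
open import Algebra.Properties.CommutativeMonoid.Sum +-0-commutativeMonoid using (sum-syntax; sum-cong-≗)
open +-*-Solver using (solve; _:+_; _:*_; _:^_; _:=_; con)

𝟙 : Bool → ℕ
𝟙 true = 1
𝟙 false = 0

𝟙-mono : ∀ {x y} → (x ≡ true → y ≡ true) → 𝟙 x ≤ 𝟙 y
𝟙-mono {false} _ = z≤n
𝟙-mono {true} x⇒y rewrite x⇒y refl = ≤-refl

∧-≡true : ∀ {x y} → x ≡ true → y ≡ true → x ∧ y ≡ true
∧-≡true refl refl = refl

∧-≡true⁻ : ∀ x {y} → x ∧ y ≡ true → x ≡ true × y ≡ true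
∧-≡true⁻ true eq = refl , eq

∧-≡trueʳ : ∀ x {y} → x ∧ y ≡ true → y ≡ true
∧-≡trueʳ x = proj₂ ∘ ∧-≡true⁻ x

dec-true⁻¹ : ∀ {P : Set} (p? : Dec P) → does p? ≡ true → P
dec-true⁻¹ (yes p) _ = p

count : {A : Set} → (A → Bool) → List A → ℕ
count p xs = length (filterᵇ p xs)

count-++ : ∀ {A : Set} (p : A → Bool) xs ys → count p (xs ++ ys) ≡ count p xs + count p ys
count-++ p xs ys = trans (cong length (filter-++ _ xs ys)) (length-++ (filterᵇ p xs))

module _ {A B : Set} (p : B → Bool) where

  count-concatMap-tabulate : ∀ {n} (f : A → List B) (g : Fin n → A) →
    count p (concatMap f (tabulate g)) ≡ ∑[ i < n ] count p (f (g i))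
  count-concatMap-tabulate {zero} f g = refl
  count-concatMap-tabulate {suc n} f g = trans (count-++ p (f (g zero)) _)
    (cong (count p (f (g zero)) +_) (count-concatMap-tabulate f (g ∘ suc)))

  count-map-tabulate : ∀ {n} (f : A → B) (g : Fin n → A) →
    count p (map f (tabulate g)) ≡ ∑[ i < n ] 𝟙 (p (f (g i)))
  count-map-tabulate {zero} f g = refl
  count-map-tabulate {suc n} f g with p (f (g zero))
  ... | true = cong suc (count-map-tabulate f (g ∘ suc))
  ... | false = count-map-tabulate f (g ∘ suc)

count-allQuads : ∀ {n} (p : Quad n → Bool) →
  count p (allQuads n) ≡ ∑[ a < n ] ∑[ b < n ] ∑[ c < n ] ∑[ d < n ] 𝟙 (p (a , b , c , d))
count-allQuads {n} p =
  trans (count-concatMap-tabulate p (λ a → concatMap (λ b → concatMap (quads a b) (allFin n)) (allFin n)) id)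
  (sum-cong-≗ λ a → trans (count-concatMap-tabulate p (λ b → concatMap (quads a b) (allFin n)) id)
  (sum-cong-≗ λ b → trans (count-concatMap-tabulate p (quads a b) id)
  (sum-cong-≗ λ c → count-map-tabulate p (λ d → (a , b , c , d)) id)))
  where
  quads : Fin n → Fin n → Fin n → List (Quad n)
  quads a b c = map (λ d → (a , b , c , d)) (allFin n)

∑-split : ∀ m k (f : Fin (m + k) → ℕ) →
  ∑[ i < m + k ] f i ≡ ∑[ i < m ] f (i ↑ˡ k) + ∑[ j < k ] f (m ↑ʳ j)
∑-split zero k f = refl
∑-split (suc m) k f = trans (cong (f zero +_) (∑-split m k (f ∘ suc))) (sym (+-assoc (f zero) _ _))

∑-combine : ∀ m k (f : Fin (m * k) → ℕ) →
  ∑[ i < m * k ] f i ≡ ∑[ i < m ] ∑[ j < k ] f (combine i j)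
∑-combine zero k f = refl
∑-combine (suc m) k f = trans (∑-split k (m * k) f)
  (cong (∑[ j < k ] f (j ↑ˡ (m * k)) +_) (∑-combine m k (λ i → f (k ↑ʳ i))))

∑-inject≤ : ∀ {m n} (m≤n : m ≤ n) (f : Fin n → ℕ) → ∑[ i < m ] f (inject≤ i m≤n) ≤ ∑[ i < n ] f i
∑-inject≤ {zero} m≤n f = z≤n
∑-inject≤ {suc m} {suc n} m≤n f = +-monoʳ-≤ (f zero) (∑-inject≤ (s≤s⁻¹ m≤n) (f ∘ suc))

toℕ-mod : ∀ {m n} .{{_ : NonZero n}} → m < n → toℕ (m mod n) ≡ m
toℕ-mod m<n = trans (Fin.toℕ-fromℕ< _) (m<n⇒m%n≡m m<n)

BitVec : ℕ → Set
BitVec = Vec Bool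

module _ {t : ℕ} where

  infixl 6 _⊕_

  _⊕_ : BitVec t → BitVec t → BitVec t
  _⊕_ = zipWith _xor_

  𝟎 : BitVec t
  𝟎 = replicate t false

  ⊕-comm : ∀ x y → x ⊕ y ≡ y ⊕ x
  ⊕-comm = zipWith-comm Bool.xor-comm

  ⊕-assoc : ∀ x y z → x ⊕ y ⊕ z ≡ x ⊕ (y ⊕ z)
  ⊕-assoc = zipWith-assoc Bool.xor-assoc

  ⊕-identityˡ : ∀ x → 𝟎 ⊕ x ≡ x
  ⊕-identityˡ = zipWith-identityˡ Bool.xor-identityˡ

  ⊕-identityʳ : ∀ x → x ⊕ 𝟎 ≡ x
  ⊕-identityʳ = zipWith-identityʳ Bool.xor-identityʳ

⊕-self : ∀ {t} (x : BitVec t) → x ⊕ x ≡ 𝟎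
⊕-self [] = refl
⊕-self (b ∷ x) = cong₂ _∷_ (Bool.xor-same b) (⊕-self x)

module _ {t : ℕ} where

  ⊕-cancelˡ : ∀ (x y : BitVec t) → x ⊕ (x ⊕ y) ≡ y
  ⊕-cancelˡ x y = trans (sym (⊕-assoc x x y)) (trans (cong (_⊕ y) (⊕-self x)) (⊕-identityˡ y))

  ⊕-cancelʳ : ∀ (x y : BitVec t) → x ⊕ y ⊕ y ≡ x
  ⊕-cancelʳ x y = trans (⊕-assoc x y y) (trans (cong (x ⊕_) (⊕-self y)) (⊕-identityʳ x))

  ⊕-swap : ∀ (x y z : BitVec t) → x ⊕ y ⊕ z ≡ x ⊕ z ⊕ y
  ⊕-swap x y z = trans (⊕-assoc x y z) (trans (cong (x ⊕_) (⊕-comm y z)) (sym (⊕-assoc x z y)))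

  ⊕-telescope : ∀ (x y z : BitVec t) → (x ⊕ y) ⊕ (y ⊕ z) ≡ x ⊕ z
  ⊕-telescope x y z = trans (⊕-assoc x y (y ⊕ z)) (cong (x ⊕_) (⊕-cancelˡ y z))

  ⊕-injectiveʳ : ∀ (x : BitVec t) {y z} → x ⊕ y ≡ x ⊕ z → y ≡ z
  ⊕-injectiveʳ x {y} {z} eq = trans (sym (⊕-cancelˡ x y)) (trans (cong (x ⊕_) eq) (⊕-cancelˡ x z))

  x≡x⊕y⇒y≡𝟎 : ∀ {x y : BitVec t} → x ≡ x ⊕ y → y ≡ 𝟎
  x≡x⊕y⇒y≡𝟎 {x} eq = ⊕-injectiveʳ x (trans (sym eq) (sym (⊕-identityʳ x)))

  ⊕≡𝟎⇒≡ : ∀ {x y : BitVec t} → x ⊕ y ≡ 𝟎 → x ≡ y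
  ⊕≡𝟎⇒≡ {x} eq = ⊕-injectiveʳ x (trans (⊕-self x) (sym eq))

infix 4 _≟_
_≟_ : ∀ {t} → DecidableEquality (BitVec t)
_≟_ = ≡-dec Bool._≟_

infix 4 _∈?_
_∈?_ : ∀ {t} (x : BitVec t) (xs : List (BitVec t)) → Dec (x ∈ xs)
_∈?_ = DecMembership._∈?_ _≟_

open Inverse Fin.2↔Bool using (to; from; strictlyInverseˡ; strictlyInverseʳ)

toFin : ∀ {t} → BitVec t → Fin (2 ^ t)
toFin [] = zero
toFin (b ∷ x) = combine (from b) (toFin x)

fromFin : ∀ {t} → Fin (2 ^ t) → BitVec t
fromFin {zero} _ = []
fromFin {suc t} i = let (b , j) = remQuot (2 ^ t) i in to b ∷ fromFin j

fromFin-toFin : ∀ {t} (x : BitVec t) → fromFin (toFin x) ≡ x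
fromFin-toFin [] = refl
fromFin-toFin (b ∷ x) = trans (cong (λ (c , j) → to c ∷ fromFin j) (Fin.remQuot-combine (from b) (toFin x)))
                              (cong₂ _∷_ (strictlyInverseˡ b) (fromFin-toFin x))

toFin-fromFin : ∀ {t} (i : Fin (2 ^ t)) → toFin (fromFin {t} i) ≡ i
toFin-fromFin {zero} zero = refl
toFin-fromFin {suc t} i = let (b , j) = remQuot (2 ^ t) i in
  trans (cong₂ combine (strictlyInverseʳ b) (toFin-fromFin {t} j)) (Fin.combine-remQuot (2 ^ t) i)

toFin-injective : ∀ {t} {x y : BitVec t} → toFin x ≡ toFin y → x ≡ y
toFin-injective {x = x} {y} eq = trans (sym (fromFin-toFin x)) (trans (cong fromFin eq) (fromFin-toFin y))

fromFin-injective : ∀ {t} {i j : Fin (2 ^ t)} → fromFin {t} i ≡ fromFin j → i ≡ j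
fromFin-injective {t} {i} {j} eq = trans (sym (toFin-fromFin {t} i)) (trans (cong toFin eq) (toFin-fromFin {t} j))

length<⇒∃∉ : ∀ {t} (xs : List (BitVec t)) → length xs < 2 ^ t → ∃ λ x → x ∉ xs
length<⇒∃∉ {t} xs short with Fin.¬∀⟶∃¬ (2 ^ t) (λ i → fromFin i ∈ xs) (λ i → fromFin i ∈? xs) ¬all∈
  where
  ¬all∈ : ¬ (∀ i → fromFin i ∈ xs)
  ¬all∈ all∈ with Fin.pigeonhole short (λ i → index (all∈ i))
  ... | i , j , i<j , same = Fin.<⇒≢ i<j (fromFin-injective (trans (lookup-index (all∈ i))
                               (trans (cong (lookup xs) same) (sym (lookup-index (all∈ j))))))
... | i , i∉ = fromFin i , i∉

∑ᵇ : ∀ t → (BitVec t → ℕ) → ℕ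
∑ᵇ zero f = f []
∑ᵇ (suc t) f = ∑ᵇ t (λ x → f (false ∷ x)) + ∑ᵇ t (λ x → f (true ∷ x))

∑ᵇ-cong : ∀ t {f g : BitVec t → ℕ} → (∀ x → f x ≡ g x) → ∑ᵇ t f ≡ ∑ᵇ t g
∑ᵇ-cong zero eq = eq []
∑ᵇ-cong (suc t) eq = cong₂ _+_ (∑ᵇ-cong t (eq ∘ (false ∷_))) (∑ᵇ-cong t (eq ∘ (true ∷_)))

∑ᵇ-mono-≤ : ∀ t {f g : BitVec t → ℕ} → (∀ x → f x ≤ g x) → ∑ᵇ t f ≤ ∑ᵇ t g
∑ᵇ-mono-≤ zero le = le []
∑ᵇ-mono-≤ (suc t) le = +-mono-≤ (∑ᵇ-mono-≤ t (le ∘ (false ∷_))) (∑ᵇ-mono-≤ t (le ∘ (true ∷_)))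

∑ᵇ-distrib-+ : ∀ t (f g : BitVec t → ℕ) → ∑ᵇ t (λ x → f x + g x) ≡ ∑ᵇ t f + ∑ᵇ t g
∑ᵇ-distrib-+ zero f g = refl
∑ᵇ-distrib-+ (suc t) f g = trans
  (cong₂ _+_ (∑ᵇ-distrib-+ t (f ∘ (false ∷_)) (g ∘ (false ∷_))) (∑ᵇ-distrib-+ t (f ∘ (true ∷_)) (g ∘ (true ∷_))))
  (interchange +-commutativeSemigroup (∑ᵇ t (f ∘ (false ∷_))) (∑ᵇ t (g ∘ (false ∷_))) (∑ᵇ t (f ∘ (true ∷_))) (∑ᵇ t (g ∘ (true ∷_))))

∑ᵇ-distribʳ-* : ∀ t (f : BitVec t → ℕ) c → ∑ᵇ t (λ x → f x * c) ≡ ∑ᵇ t f * c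
∑ᵇ-distribʳ-* zero f c = refl
∑ᵇ-distribʳ-* (suc t) f c = trans
  (cong₂ _+_ (∑ᵇ-distribʳ-* t (f ∘ (false ∷_)) c) (∑ᵇ-distribʳ-* t (f ∘ (true ∷_)) c))
  (sym (*-distribʳ-+ c (∑ᵇ t (f ∘ (false ∷_))) (∑ᵇ t (f ∘ (true ∷_)))))

∑ᵇ-const : ∀ t c → ∑ᵇ t (λ _ → c) ≡ 2 ^ t * c
∑ᵇ-const zero c = sym (+-identityʳ c)
∑ᵇ-const (suc t) c = trans (cong₂ _+_ (∑ᵇ-const t c) (∑ᵇ-const t c))
  (sym (trans (*-distribʳ-+ c (2 ^ t) (2 ^ t + 0)) (cong (λ m → 2 ^ t * c + m * c) (+-identityʳ (2 ^ t)))))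

term≤∑ᵇ : ∀ t (f : BitVec t → ℕ) x → f x ≤ ∑ᵇ t f
term≤∑ᵇ zero f [] = ≤-refl
term≤∑ᵇ (suc t) f (false ∷ x) = ≤-trans (term≤∑ᵇ t (f ∘ (false ∷_)) x) (m≤m+n _ _)
term≤∑ᵇ (suc t) f (true ∷ x) = ≤-trans (term≤∑ᵇ t (f ∘ (true ∷_)) x) (m≤n+m _ _)

∑ᵇ-translate : ∀ t (f : BitVec t → ℕ) w → ∑ᵇ t (λ x → f (w ⊕ x)) ≡ ∑ᵇ t f
∑ᵇ-translate zero f [] = refl
∑ᵇ-translate (suc t) f (false ∷ w) =
  cong₂ _+_ (∑ᵇ-translate t (f ∘ (false ∷_)) w) (∑ᵇ-translate t (f ∘ (true ∷_)) w)
∑ᵇ-translate (suc t) f (true ∷ w) = trans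
  (cong₂ _+_ (∑ᵇ-translate t (f ∘ (true ∷_)) w) (∑ᵇ-translate t (f ∘ (false ∷_)) w))
  (+-comm (∑ᵇ t (f ∘ (true ∷_))) (∑ᵇ t (f ∘ (false ∷_))))

∑ᵇ-δ : ∀ t (w : BitVec t) → ∑ᵇ t (λ x → 𝟙 (does (x ≟ w))) ≡ 1
∑ᵇ-δ zero [] = refl
∑ᵇ-δ (suc t) (false ∷ w) = trans (cong₂ _+_ (∑ᵇ-δ t w) (∑ᵇ-const t 0)) (cong suc (*-zeroʳ (2 ^ t)))
∑ᵇ-δ (suc t) (true ∷ w) = trans (cong₂ _+_ (∑ᵇ-const t 0) (∑ᵇ-δ t w)) (cong (_+ 1) (*-zeroʳ (2 ^ t)))

∑-toFin : ∀ t (f : Fin (2 ^ t) → ℕ) → ∑[ i < 2 ^ t ] f i ≡ ∑ᵇ t (f ∘ toFin)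
∑-toFin zero f = +-identityʳ _
∑-toFin (suc t) f = begin
  ∑[ i < 2 ^ suc t ] f i                                    ≡⟨ ∑-combine 2 (2 ^ t) f ⟩
  ∑[ j < 2 ^ t ] f (c₀ j) + (∑[ j < 2 ^ t ] f (c₁ j) + 0)   ≡⟨ cong (∑[ j < 2 ^ t ] f (c₀ j) +_) (+-identityʳ _) ⟩
  ∑[ j < 2 ^ t ] f (c₀ j) + ∑[ j < 2 ^ t ] f (c₁ j)         ≡⟨ cong₂ _+_ (∑-toFin t (f ∘ c₀)) (∑-toFin t (f ∘ c₁)) ⟩
  ∑ᵇ (suc t) (f ∘ toFin)                                    ∎
  where
  open ≡-Reasoning
  c₀ c₁ : Fin (2 ^ t) → Fin (2 ^ suc t)
  c₀ = combine {m = 2} zero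
  c₁ = combine {m = 2} (suc zero)

∑ᵇ-parallelograms≤ : ∀ t (f : BitVec t → BitVec t → BitVec t → ℕ) x →
  ∑ᵇ t (λ s₁ → ∑ᵇ t λ s₂ → f (x ⊕ s₁) (x ⊕ s₁ ⊕ s₂) (x ⊕ s₂)) ≤ ∑ᵇ t (λ b → ∑ᵇ t λ c → ∑ᵇ t λ d → f b c d)
∑ᵇ-parallelograms≤ t f x = begin
  ∑ᵇ t (λ s₁ → ∑ᵇ t λ s₂ → f (x ⊕ s₁) (x ⊕ s₁ ⊕ s₂) (x ⊕ s₂))
    ≤⟨ ∑ᵇ-mono-≤ t (λ s₁ → ∑ᵇ-mono-≤ t λ s₂ → term≤∑ᵇ t (f (x ⊕ s₁) (x ⊕ s₁ ⊕ s₂)) (x ⊕ s₂)) ⟩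
  ∑ᵇ t (λ s₁ → ∑ᵇ t λ s₂ → ∑ᵇ t λ d → f (x ⊕ s₁) (x ⊕ s₁ ⊕ s₂) d)
    ≡⟨ ∑ᵇ-cong t (λ s₁ → ∑ᵇ-translate t (λ c → ∑ᵇ t (f (x ⊕ s₁) c)) (x ⊕ s₁)) ⟩
  ∑ᵇ t (λ s₁ → ∑ᵇ t λ c → ∑ᵇ t λ d → f (x ⊕ s₁) c d)
    ≡⟨ ∑ᵇ-translate t (λ b → ∑ᵇ t λ c → ∑ᵇ t (f b c)) x ⟩
  ∑ᵇ t (λ b → ∑ᵇ t λ c → ∑ᵇ t λ d → f b c d) ∎
  where open ≤-Reasoning

module _ {t : ℕ} where

  private
    𝟙-∈?-∷ : ∀ {y : BitVec t} {S} → y ∉ S → ∀ x →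
             𝟙 (does (x ≟ y) ∨ does (x ∈? S)) ≡ 𝟙 (does (x ≟ y)) + 𝟙 (does (x ∈? S))
    𝟙-∈?-∷ {y} {S} y∉S x with x ≟ y
    ... | yes refl rewrite dec-false (x ∈? S) y∉S = refl
    ... | no _ = refl

    𝟙-∈?-split : ∀ {s₁ : BitVec t} {S} → s₁ ∈ S → ∀ s₂ →
                 𝟙 (does (s₂ ∈? S)) ≡ 𝟙 (does (s₂ ∈? S) ∧ not (does (s₂ ≟ s₁))) + 𝟙 (does (s₂ ≟ s₁))
    𝟙-∈?-split {s₁} {S} s₁∈ s₂ with s₂ ≟ s₁
    ... | yes refl rewrite dec-true (s₂ ∈? S) s₁∈ = refl
    ... | no _ = sym (trans (+-identityʳ _) (cong 𝟙 (Bool.∧-identityʳ (does (s₂ ∈? S)))))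

  ∑ᵇ-∈? : ∀ {S : List (BitVec t)} → Unique S → ∑ᵇ t (λ x → 𝟙 (does (x ∈? S))) ≡ length S
  ∑ᵇ-∈? {[]} [] = trans (∑ᵇ-const t 0) (*-zeroʳ (2 ^ t))
  ∑ᵇ-∈? {y ∷ S} (y≢S ∷ unique) = begin
    ∑ᵇ t (λ x → 𝟙 (does (x ≟ y) ∨ does (x ∈? S)))                    ≡⟨ ∑ᵇ-cong t (𝟙-∈?-∷ (All¬⇒¬Any y≢S)) ⟩
    ∑ᵇ t (λ x → 𝟙 (does (x ≟ y)) + 𝟙 (does (x ∈? S)))               ≡⟨ ∑ᵇ-distrib-+ t _ _ ⟩
    ∑ᵇ t (λ x → 𝟙 (does (x ≟ y))) + ∑ᵇ t (λ x → 𝟙 (does (x ∈? S)))  ≡⟨ cong₂ _+_ (∑ᵇ-δ t y) (∑ᵇ-∈? unique) ⟩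
    suc (length S)                                                  ∎
    where open ≡-Reasoning

  ∑ᵇ-∈?-∖ : ∀ {S : List (BitVec t)} {s₁} → Unique S → s₁ ∈ S →
            ∑ᵇ t (λ s₂ → 𝟙 (does (s₂ ∈? S) ∧ not (does (s₂ ≟ s₁)))) ≡ length S ∸ 1
  ∑ᵇ-∈?-∖ {S} {s₁} unique s₁∈ = sym (begin
    length S ∸ 1                                                   ≡⟨ cong (_∸ 1) (∑ᵇ-∈? unique) ⟨
    ∑ᵇ t (λ s₂ → 𝟙 (does (s₂ ∈? S))) ∸ 1                           ≡⟨ cong (_∸ 1) (∑ᵇ-cong t (𝟙-∈?-split s₁∈)) ⟩
    ∑ᵇ t (λ s₂ → 𝟙 (others s₂) + 𝟙 (does (s₂ ≟ s₁))) ∸ 1           ≡⟨ cong (_∸ 1) (∑ᵇ-distrib-+ t _ _) ⟩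
    ∑ᵇ t (𝟙 ∘ others) + ∑ᵇ t (λ s₂ → 𝟙 (does (s₂ ≟ s₁))) ∸ 1       ≡⟨ cong (λ m → ∑ᵇ t (𝟙 ∘ others) + m ∸ 1) (∑ᵇ-δ t s₁) ⟩
    ∑ᵇ t (𝟙 ∘ others) + 1 ∸ 1                                      ≡⟨ m+n∸n≡m _ 1 ⟩
    ∑ᵇ t (𝟙 ∘ others)                                              ∎)
    where
    open ≡-Reasoning
    others : BitVec t → Bool
    others s₂ = does (s₂ ∈? S) ∧ not (does (s₂ ≟ s₁))

  DistinctPair : List (BitVec t) → BitVec t → BitVec t → Bool
  DistinctPair S s₁ s₂ = does (s₁ ∈? S) ∧ (does (s₂ ∈? S) ∧ not (does (s₂ ≟ s₁)))

  DistinctPair⇒ : ∀ {S : List (BitVec t)} s₁ s₂ → DistinctPair S s₁ s₂ ≡ true → s₁ ∈ S × s₂ ∈ S × s₁ ≢ s₂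
  DistinctPair⇒ {S} s₁ s₂ _ with s₁ ∈? S | s₂ ∈? S | s₂ ≟ s₁
  ... | yes s₁∈ | yes s₂∈ | no s₂≢s₁ = s₁∈ , s₂∈ , s₂≢s₁ ∘ sym

  ∑ᵇ-distinctPairs : ∀ {S : List (BitVec t)} → Unique S →
    ∑ᵇ t (λ s₁ → ∑ᵇ t λ s₂ → 𝟙 (DistinctPair S s₁ s₂)) ≡ length S * (length S ∸ 1)
  ∑ᵇ-distinctPairs {S} unique = begin
    ∑ᵇ t (λ s₁ → ∑ᵇ t λ s₂ → 𝟙 (DistinctPair S s₁ s₂))    ≡⟨ ∑ᵇ-cong t pairsFrom ⟩
    ∑ᵇ t (λ s₁ → 𝟙 (does (s₁ ∈? S)) * (length S ∸ 1))      ≡⟨ ∑ᵇ-distribʳ-* t _ _ ⟩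
    ∑ᵇ t (λ s₁ → 𝟙 (does (s₁ ∈? S))) * (length S ∸ 1)      ≡⟨ cong (_* (length S ∸ 1)) (∑ᵇ-∈? unique) ⟩
    length S * (length S ∸ 1)                               ∎
    where
    open ≡-Reasoning
    pairsFrom : ∀ s₁ → ∑ᵇ t (λ s₂ → 𝟙 (does (s₁ ∈? S) ∧ (does (s₂ ∈? S) ∧ not (does (s₂ ≟ s₁)))))
                       ≡ 𝟙 (does (s₁ ∈? S)) * (length S ∸ 1)
    pairsFrom s₁ with s₁ ∈? S
    ... | yes s₁∈ = trans (∑ᵇ-∈?-∖ unique s₁∈) (sym (+-identityʳ _))
    ... | no _ = trans (∑ᵇ-const t 0) (*-zeroʳ (2 ^ t))

module _ {t : ℕ} where

  -- For distinct a, b, c, asking a ⊕ b ⊕ c ∉ S is asking that no four distinct members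
  -- of S sum to 𝟎; excluding 𝟎 makes the Cayley graph below loopless.
  record SidonSet (S : List (BitVec t)) : Set where
    field
      𝟎∉ : 𝟎 ∉ S
      unique : Unique S
      sidon : ∀ {a b c} → a ∈ S → b ∈ S → c ∈ S → a ≢ b → a ≢ c → b ≢ c → a ⊕ b ⊕ c ∉ S

  triples : List (BitVec t) → List (BitVec t)
  triples S = cartesianProductWith _⊕_ (cartesianProductWith _⊕_ S S) S

  ∈-triples : ∀ {S a b c} → a ∈ S → b ∈ S → c ∈ S → a ⊕ b ⊕ c ∈ triples S
  ∈-triples a∈ b∈ c∈ = ∈-cartesianProductWith⁺ _⊕_ (∈-cartesianProductWith⁺ _⊕_ a∈ b∈) c∈

  SidonSet-∷ : ∀ {S x} → SidonSet S → x ∉ 𝟎 ∷ triples S → SidonSet (x ∷ S)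
  SidonSet-∷ {S} {x} sidonSet x∉ = record { 𝟎∉ = 𝟎∉′ ; unique = ¬Any⇒All¬ S x∉S ∷ unique ; sidon = sidon′ }
    where
    open SidonSet sidonSet

    x∉triples : x ∉ triples S
    x∉triples = x∉ ∘ there

    x∉S : x ∉ S
    x∉S x∈ = x∉triples (subst (_∈ triples S) (trans (cong (_⊕ x) (⊕-self x)) (⊕-identityˡ x)) (∈-triples x∈ x∈ x∈))

    𝟎∉′ : 𝟎 ∉ x ∷ S
    𝟎∉′ (here 𝟎≡x) = x∉ (here (sym 𝟎≡x))
    𝟎∉′ (there 𝟎∈) = 𝟎∉ 𝟎∈

    x⊕old⊕old∉ : ∀ {b c d} → b ∈ S → c ∈ S → b ≢ c → d ≡ x ⊕ b ⊕ c → d ∉ x ∷ S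
    x⊕old⊕old∉ {b} {c} b∈ c∈ b≢c refl (here d≡x) =
      b≢c (⊕≡𝟎⇒≡ (x≡x⊕y⇒y≡𝟎 (trans (sym d≡x) (⊕-assoc x b c))))
    x⊕old⊕old∉ {b} {c} b∈ c∈ b≢c refl (there d∈) =
      x∉triples (subst (_∈ triples S) d⊕b⊕c≡x (∈-triples d∈ b∈ c∈))
      where
      d⊕b⊕c≡x : x ⊕ b ⊕ c ⊕ b ⊕ c ≡ x
      d⊕b⊕c≡x = trans (cong (_⊕ c) (trans (⊕-swap (x ⊕ b) c b) (cong (_⊕ c) (⊕-cancelʳ x b)))) (⊕-cancelʳ x c)

    sidon′ : ∀ {a b c} → a ∈ x ∷ S → b ∈ x ∷ S → c ∈ x ∷ S → a ≢ b → a ≢ c → b ≢ c → a ⊕ b ⊕ c ∉ x ∷ S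
    sidon′ (here refl) (here refl) _ a≢b _ _ = contradiction refl a≢b
    sidon′ (here refl) _ (here refl) _ a≢c _ = contradiction refl a≢c
    sidon′ _ (here refl) (here refl) _ _ b≢c = contradiction refl b≢c
    sidon′ (here refl) (there b∈) (there c∈) _ _ b≢c = x⊕old⊕old∉ b∈ c∈ b≢c refl
    sidon′ {a} {c = c} (there a∈) (here refl) (there c∈) _ a≢c _ =
      x⊕old⊕old∉ a∈ c∈ a≢c (cong (_⊕ c) (⊕-comm a x))
    sidon′ {a} {b} (there a∈) (there b∈) (here refl) a≢b _ _ =
      x⊕old⊕old∉ a∈ b∈ a≢b (trans (⊕-comm (a ⊕ b) x) (sym (⊕-assoc x a b)))
    sidon′ (there a∈) (there b∈) (there c∈) _ _ _ (here s≡x) =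
      x∉triples (subst (_∈ triples S) s≡x (∈-triples a∈ b∈ c∈))
    sidon′ (there a∈) (there b∈) (there c∈) a≢b a≢c b≢c (there s∈) = sidon a∈ b∈ c∈ a≢b a≢c b≢c s∈

length-cartesianProductWith : ∀ {A B C : Set} (f : A → B → C) xs ys →
  length (cartesianProductWith f xs ys) ≡ length xs * length ys
length-cartesianProductWith f [] ys = refl
length-cartesianProductWith f (x ∷ xs) ys = trans (length-++ (map (f x) ys))
  (cong₂ _+_ (length-map (f x) ys) (length-cartesianProductWith f xs ys))

module _ {t : ℕ} where

  length-triples : (S : List (BitVec t)) → length (triples S) ≡ length S ^ 3
  length-triples S = begin
    length (triples S)                                ≡⟨ length-cartesianProductWith _⊕_ (cartesianProductWith _⊕_ S S) S ⟩
    length (cartesianProductWith _⊕_ S S) * length S  ≡⟨ cong (_* length S) (length-cartesianProductWith _⊕_ S S) ⟩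
    length S * length S * length S                    ≡⟨ *-assoc (length S) _ _ ⟩
    length S * (length S * length S)                  ≡⟨ cong (λ m → length S * (length S * m)) (*-identityʳ (length S)) ⟨
    length S ^ 3                                      ∎
    where open ≡-Reasoning

  greedySidonSet : ∀ a → a ^ 3 < 2 ^ t → Σ[ S ∈ List (BitVec t) ] SidonSet S × length S ≡ a
  greedySidonSet zero _ = [] , record { 𝟎∉ = λ () ; unique = [] ; sidon = λ () } , refl
  greedySidonSet (suc a) bound with greedySidonSet a (<-trans (^-monoˡ-< 3 (n<1+n a)) bound)
  ... | S , sidonSet , refl with length<⇒∃∉ (𝟎 ∷ triples S)
        (subst (λ m → suc m < 2 ^ t) (sym (length-triples S)) (≤-<-trans (^-monoˡ-< 3 (n<1+n (length S))) bound))
  ...   | x , x∉ = x ∷ S , SidonSet-∷ sidonSet x∉ , refl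

Is4Cycle⇒edges : ∀ {n} (G : Graph n) a b c d → Is4Cycle G a b c d ≡ true →
  Edge G a b × Edge G b c × Edge G c d × Edge G d a
Is4Cycle⇒edges G a b c d cyc =
  let edges = ∧-≡trueʳ (c ≠ᵇ d) (∧-≡trueʳ (b ≠ᵇ d) (∧-≡trueʳ (b ≠ᵇ c)
                (∧-≡trueʳ (a ≠ᵇ d) (∧-≡trueʳ (a ≠ᵇ c) (∧-≡trueʳ (a ≠ᵇ b) cyc)))))
      ab , edges = ∧-≡true⁻ (adj G a b) edges
      bc , edges = ∧-≡true⁻ (adj G b c) edges
      cd , da = ∧-≡true⁻ (adj G c d) edges
  in ab , bc , cd , da

cycleTuples-∑ : ∀ {n} (G : Graph n) →
  cycleTuples G ≡ ∑[ a < n ] ∑[ b < n ] ∑[ c < n ] ∑[ d < n ] 𝟙 (Is4Cycle G a b c d)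
cycleTuples-∑ G = count-allQuads (λ (a , b , c , d) → Is4Cycle G a b c d)

≠ᵇ-true : ∀ {n} {a b : Fin n} → a ≢ b → (a ≠ᵇ b) ≡ true
≠ᵇ-true {a = a} {b} a≢b = cong not (trans (isYes≗does (a Fin.≟ b)) (dec-false (a Fin.≟ b) a≢b))

-- 𝔽₂ᵗ sits on the first 2 ^ t elements of Fin n; on the others, label is a junk value.
module Embedding {t n : ℕ} (2^t≤n : 2 ^ t ≤ n) where

  private instance
    2^t≢0 : NonZero (2 ^ t)
    2^t≢0 = m^n≢0 2 t

  vertex : BitVec t → Fin n
  vertex x = inject≤ (toFin x) 2^t≤n

  isVertex? : (u : Fin n) → Dec (toℕ u < 2 ^ t)
  isVertex? u = toℕ u <? 2 ^ t

  label : Fin n → BitVec t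
  label u = fromFin (toℕ u mod 2 ^ t)

  toℕ-vertex : ∀ x → toℕ (vertex x) ≡ toℕ (toFin x)
  toℕ-vertex x = Fin.toℕ-inject≤ (toFin x) 2^t≤n

  vertex<2^t : ∀ x → toℕ (vertex x) < 2 ^ t
  vertex<2^t x = subst (_< 2 ^ t) (sym (toℕ-vertex x)) (Fin.toℕ<n (toFin x))

  label-vertex : ∀ x → label (vertex x) ≡ x
  label-vertex x = trans (cong (fromFin {t}) (Fin.toℕ-injective (trans (toℕ-mod (vertex<2^t x)) (toℕ-vertex x))))
                         (fromFin-toFin x)

  vertex-label : ∀ {u} → toℕ u < 2 ^ t → vertex (label u) ≡ u
  vertex-label {u} u<2^t = Fin.toℕ-injective (begin
    toℕ (vertex (label u))                       ≡⟨ toℕ-vertex (label u) ⟩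
    toℕ (toFin (fromFin {t} (toℕ u mod 2 ^ t)))  ≡⟨ cong toℕ (toFin-fromFin {t} (toℕ u mod 2 ^ t)) ⟩
    toℕ (toℕ u mod 2 ^ t)                        ≡⟨ toℕ-mod u<2^t ⟩
    toℕ u                                        ∎)
    where open ≡-Reasoning

  ∑ᵇ-vertex≤ : ∀ (f : Fin n → ℕ) → ∑ᵇ t (f ∘ vertex) ≤ ∑[ u < n ] f u
  ∑ᵇ-vertex≤ f = begin
    ∑ᵇ t (f ∘ vertex)                     ≡⟨ ∑-toFin t (λ i → f (inject≤ i 2^t≤n)) ⟨
    ∑[ i < 2 ^ t ] f (inject≤ i 2^t≤n)    ≤⟨ ∑-inject≤ 2^t≤n f ⟩
    ∑[ u < n ] f u                        ∎
    where open ≤-Reasoning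

  ∑ᵇ-vertex-mono-≤ : ∀ {f g : Fin n → ℕ} → (∀ u → f u ≤ g u) → ∑ᵇ t (f ∘ vertex) ≤ ∑[ u < n ] g u
  ∑ᵇ-vertex-mono-≤ {g = g} f≤g = ≤-trans (∑ᵇ-mono-≤ t (f≤g ∘ vertex)) (∑ᵇ-vertex≤ g)

  ∑ᵇ⁴-vertex≤ : ∀ (f : Fin n → Fin n → Fin n → Fin n → ℕ) →
    ∑ᵇ t (λ a → ∑ᵇ t λ b → ∑ᵇ t λ c → ∑ᵇ t λ d → f (vertex a) (vertex b) (vertex c) (vertex d))
      ≤ ∑[ a < n ] ∑[ b < n ] ∑[ c < n ] ∑[ d < n ] f a b c d
  ∑ᵇ⁴-vertex≤ f = ∑ᵇ-vertex-mono-≤ λ a → ∑ᵇ-vertex-mono-≤ λ b → ∑ᵇ-vertex-mono-≤ λ c → ∑ᵇ-vertex≤ (f a b c)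

module CayleyGraph {t : ℕ} {S : List (BitVec t)} (sidonSet : SidonSet S) {n : ℕ} (2^t≤n : 2 ^ t ≤ n) where

  open Embedding {t} 2^t≤n
  open SidonSet sidonSet

  adjacent : Fin n → Fin n → Bool
  adjacent u w = (does (isVertex? u) ∧ does (isVertex? w)) ∧ does (label u ⊕ label w ∈? S)

  G : Graph n
  G = record
    { adj = adjacent
    ; adj-sym = λ u w → cong₂ _∧_ (Bool.∧-comm (does (isVertex? u)) _) (cong (λ s → does (s ∈? S)) (⊕-comm (label u) (label w)))
    ; adj-irrefl = λ u → let u-vertex = does (isVertex? u) ∧ does (isVertex? u) in
        trans (cong (λ s → u-vertex ∧ does (s ∈? S)) (⊕-self (label u)))
              (trans (cong (u-vertex ∧_) (dec-false (𝟎 ∈? S) 𝟎∉)) (Bool.∧-zeroʳ u-vertex))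
    }

  colour : Colouring n
  colour u w = toℕ (toFin (label u ⊕ label w))

  edge⇒ : ∀ {u w} → Edge G u w → toℕ u < 2 ^ t × toℕ w < 2 ^ t × label u ⊕ label w ∈ S
  edge⇒ {u} {w} uw =
    let vertices , diff∈ = ∧-≡true⁻ (does (isVertex? u) ∧ does (isVertex? w)) uw
        u-vertex , w-vertex = ∧-≡true⁻ (does (isVertex? u)) vertices
    in dec-true⁻¹ (isVertex? u) u-vertex , dec-true⁻¹ (isVertex? w) w-vertex , dec-true⁻¹ (label u ⊕ label w ∈? S) diff∈

  vertex-edge : ∀ {x y} → x ⊕ y ∈ S → Edge G (vertex x) (vertex y)
  vertex-edge {x} {y} x⊕y∈ =
    ∧-≡true (∧-≡true (dec-true (isVertex? (vertex x)) (vertex<2^t x)) (dec-true (isVertex? (vertex y)) (vertex<2^t y)))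
      (dec-true (label (vertex x) ⊕ label (vertex y) ∈? S)
                (subst (_∈ S) (sym (cong₂ _⊕_ (label-vertex x) (label-vertex y))) x⊕y∈))

  vertex-≠ᵇ : ∀ {x y} → x ≢ y → (vertex x ≠ᵇ vertex y) ≡ true
  vertex-≠ᵇ {x} {y} x≢y = ≠ᵇ-true (λ eq → x≢y (trans (sym (label-vertex x)) (trans (cong label eq) (label-vertex y))))

  isEdgeColouring : IsEdgeColouring G colour
  isEdgeColouring u w _ = cong (toℕ ∘ toFin) (⊕-comm (label u) (label w))

  isProper : IsProper G colour
  isProper u v w uv uw v≢w same = v≢w (begin
    v                  ≡⟨ vertex-label (proj₁ (proj₂ (edge⇒ uv))) ⟨
    vertex (label v)   ≡⟨ cong vertex (⊕-injectiveʳ (label u) (toFin-injective (Fin.toℕ-injective same))) ⟩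
    vertex (label w)   ≡⟨ vertex-label (proj₁ (proj₂ (edge⇒ uw))) ⟩
    w                  ∎)
    where open ≡-Reasoning

  -- The colours around a 4-cycle encode the labels s₁, s₂, s₃, s₄ of its edges, and s₁ ⊕ s₂ ⊕ s₃ = s₄.
  noRainbowC4 : ¬ RainbowC4 G colour
  noRainbowC4 (a , b , c , d , cyc , c₁≢c₂ , c₁≢c₃ , _ , c₂≢c₃ , _ , _) =
    let ab , bc , cd , da = Is4Cycle⇒edges G a b c d cyc in
    sidon (diff∈ ab) (diff∈ bc) (diff∈ cd)
          (c₁≢c₂ ∘ cong (toℕ ∘ toFin)) (c₁≢c₃ ∘ cong (toℕ ∘ toFin)) (c₂≢c₃ ∘ cong (toℕ ∘ toFin))
          (subst (_∈ S) (sym telescope) (diff∈ da))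
    where
    diff∈ : ∀ {u w} → Edge G u w → label u ⊕ label w ∈ S
    diff∈ uw = proj₂ (proj₂ (edge⇒ uw))
    telescope : (label a ⊕ label b) ⊕ (label b ⊕ label c) ⊕ (label c ⊕ label d) ≡ label d ⊕ label a
    telescope = trans (cong (_⊕ (label c ⊕ label d)) (⊕-telescope (label a) (label b) (label c)))
                      (trans (⊕-telescope (label a) (label c) (label d)) (⊕-comm (label a) (label d)))

  goodColoured : GoodColoured G colour
  goodColoured = isEdgeColouring , isProper , noRainbowC4

  parallelogram : ∀ x {s₁ s₂} → s₁ ∈ S → s₂ ∈ S → s₁ ≢ s₂ →
    Is4Cycle G (vertex x) (vertex (x ⊕ s₁)) (vertex (x ⊕ s₁ ⊕ s₂)) (vertex (x ⊕ s₂)) ≡ true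
  parallelogram x {s₁} {s₂} s₁∈ s₂∈ s₁≢s₂ =
    ∧-≡true (vertex-≠ᵇ a≢b) (∧-≡true (vertex-≠ᵇ a≢c) (∧-≡true (vertex-≠ᵇ a≢d)
    (∧-≡true (vertex-≠ᵇ b≢c) (∧-≡true (vertex-≠ᵇ b≢d) (∧-≡true (vertex-≠ᵇ c≢d)
    (∧-≡true (vertex-edge ab) (∧-≡true (vertex-edge bc) (∧-≡true (vertex-edge cd) (vertex-edge da)))))))))
    where
    s₁≢𝟎 : s₁ ≢ 𝟎
    s₁≢𝟎 refl = 𝟎∉ s₁∈
    s₂≢𝟎 : s₂ ≢ 𝟎
    s₂≢𝟎 refl = 𝟎∉ s₂∈

    a≢b : x ≢ x ⊕ s₁
    a≢b = s₁≢𝟎 ∘ x≡x⊕y⇒y≡𝟎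
    a≢c : x ≢ x ⊕ s₁ ⊕ s₂
    a≢c eq = s₁≢s₂ (⊕≡𝟎⇒≡ (x≡x⊕y⇒y≡𝟎 (trans eq (⊕-assoc x s₁ s₂))))
    a≢d : x ≢ x ⊕ s₂
    a≢d = s₂≢𝟎 ∘ x≡x⊕y⇒y≡𝟎
    b≢c : x ⊕ s₁ ≢ x ⊕ s₁ ⊕ s₂
    b≢c = s₂≢𝟎 ∘ x≡x⊕y⇒y≡𝟎
    b≢d : x ⊕ s₁ ≢ x ⊕ s₂
    b≢d = s₁≢s₂ ∘ ⊕-injectiveʳ x
    c≢d : x ⊕ s₁ ⊕ s₂ ≢ x ⊕ s₂
    c≢d eq = s₁≢𝟎 (x≡x⊕y⇒y≡𝟎 (sym (trans (sym (⊕-swap x s₁ s₂)) eq)))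

    ab : x ⊕ (x ⊕ s₁) ∈ S
    ab = subst (_∈ S) (sym (⊕-cancelˡ x s₁)) s₁∈
    bc : (x ⊕ s₁) ⊕ (x ⊕ s₁ ⊕ s₂) ∈ S
    bc = subst (_∈ S) (sym (⊕-cancelˡ (x ⊕ s₁) s₂)) s₂∈
    cd : (x ⊕ s₁ ⊕ s₂) ⊕ (x ⊕ s₂) ∈ S
    cd = subst (_∈ S) (sym (trans (cong (_⊕ (x ⊕ s₂)) (⊕-swap x s₁ s₂))
                               (trans (⊕-comm (x ⊕ s₂ ⊕ s₁) (x ⊕ s₂)) (⊕-cancelˡ (x ⊕ s₂) s₁)))) s₁∈
    da : (x ⊕ s₂) ⊕ x ∈ S
    da = subst (_∈ S) (sym (trans (⊕-comm (x ⊕ s₂) x) (⊕-cancelˡ x s₂))) s₂∈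

  cyclesThrough≥ : ∀ x → length S * (length S ∸ 1) ≤
    ∑ᵇ t (λ b → ∑ᵇ t λ c → ∑ᵇ t λ d → 𝟙 (Is4Cycle G (vertex x) (vertex b) (vertex c) (vertex d)))
  cyclesThrough≥ x = begin
    length S * (length S ∸ 1)                                   ≡⟨ ∑ᵇ-distinctPairs unique ⟨
    ∑ᵇ t (λ s₁ → ∑ᵇ t λ s₂ → 𝟙 (DistinctPair S s₁ s₂))          ≤⟨ ∑ᵇ-mono-≤ t (λ s₁ → ∑ᵇ-mono-≤ t λ s₂ → 𝟙-mono (parallelogramOf s₁ s₂)) ⟩
    ∑ᵇ t (λ s₁ → ∑ᵇ t λ s₂ → C (x ⊕ s₁) (x ⊕ s₁ ⊕ s₂) (x ⊕ s₂))  ≤⟨ ∑ᵇ-parallelograms≤ t C x ⟩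
    ∑ᵇ t (λ b → ∑ᵇ t λ c → ∑ᵇ t λ d → C b c d)                   ∎
    where
    open ≤-Reasoning
    C : BitVec t → BitVec t → BitVec t → ℕ
    C b c d = 𝟙 (Is4Cycle G (vertex x) (vertex b) (vertex c) (vertex d))
    parallelogramOf : ∀ s₁ s₂ → DistinctPair S s₁ s₂ ≡ true →
      Is4Cycle G (vertex x) (vertex (x ⊕ s₁)) (vertex (x ⊕ s₁ ⊕ s₂)) (vertex (x ⊕ s₂)) ≡ true
    parallelogramOf s₁ s₂ h = let s₁∈ , s₂∈ , s₁≢s₂ = DistinctPair⇒ s₁ s₂ h in parallelogram x s₁∈ s₂∈ s₁≢s₂

  cycleTuples≥ : 2 ^ t * (length S * (length S ∸ 1)) ≤ cycleTuples G
  cycleTuples≥ = begin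
    2 ^ t * (length S * (length S ∸ 1))       ≡⟨ ∑ᵇ-const t _ ⟨
    ∑ᵇ t (λ _ → length S * (length S ∸ 1))    ≤⟨ ∑ᵇ-mono-≤ t cyclesThrough≥ ⟩
    ∑ᵇ t (λ a → ∑ᵇ t λ b → ∑ᵇ t λ c → ∑ᵇ t λ d → 𝟙 (Is4Cycle G (vertex a) (vertex b) (vertex c) (vertex d)))
                                              ≤⟨ ∑ᵇ⁴-vertex≤ (λ a b c d → 𝟙 (Is4Cycle G a b c d)) ⟩
    ∑[ a < n ] ∑[ b < n ] ∑[ c < n ] ∑[ d < n ] 𝟙 (Is4Cycle G a b c d)
                                              ≡⟨ cycleTuples-∑ G ⟨
    cycleTuples G                             ∎
    where open ≤-Reasoning

b^q≤n<b^[1+q] : ∀ b {n} .{{_ : NonZero b}} → 1 < b → 0 < n → ∃[ q ] b ^ q ≤ n × n < b ^ suc q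
b^q≤n<b^[1+q] b {suc zero} 1<b _ = 0 , ≤-refl , subst (1 <_) (sym (*-identityʳ b)) 1<b
b^q≤n<b^[1+q] b {suc (suc m)} 1<b _ with b^q≤n<b^[1+q] b {suc m} 1<b z<s
... | q , lo , hi with suc (suc m) <? b ^ suc q
...   | yes below = q , m≤n⇒m≤1+n lo , below
...   | no ¬below = suc q , ≮⇒≥ ¬below ,
          ≤-<-trans hi (subst (b ^ suc q <_) (*-comm (b ^ suc q) b) (m<m*n (b ^ suc q) b {{m^n≢0 b (suc q)}} 1<b))

a*a≤2*[a*[a∸1]] : ∀ {a} → 2 ≤ a → a * a ≤ 2 * (a * (a ∸ 1))
a*a≤2*[a*[a∸1]] {suc (suc b)} (s≤s (s≤s _)) = begin
  (2 + b) * (2 + b)                 ≤⟨ m≤m+n _ ((2 + b) * b) ⟩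
  (2 + b) * (2 + b) + (2 + b) * b   ≡⟨ solve 1 (λ b → (con 2 :+ b) :* (con 2 :+ b) :+ (con 2 :+ b) :* b
                                                   := con 2 :* ((con 2 :+ b) :* (con 1 :+ b))) refl b ⟩
  2 * ((2 + b) * (1 + b))           ∎
  where open ≤-Reasoning

m<8*[1+m/8] : ∀ m → m < 8 * suc (m / 8)
m<8*[1+m/8] m = begin-strict
  m                   ≡⟨ m≡m%n+[m/n]*n m 8 ⟩
  m % 8 + m / 8 * 8   <⟨ +-monoˡ-< (m / 8 * 8) (m%n<n m 8) ⟩
  8 + m / 8 * 8       ≡⟨ cong (8 +_) (*-comm (m / 8) 8) ⟩
  8 + 8 * (m / 8)     ≡⟨ *-suc 8 (m / 8) ⟨
  8 * suc (m / 8)     ∎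
  where open ≤-Reasoning

-- a⁶ ≤ 2C and C < 8 (C / 8 + 1), so n³ < (16 a⁴)³ = (64 a⁶)² ≤ (2048 (C / 8))².
n³≤[2048*C/8]² : ∀ {a n C} → 2 ≤ a → n < 16 * a ^ 4 → a ^ 4 * (a * (a ∸ 1)) ≤ C → n ^ 3 ≤ (2048 * (C / 8)) ^ 2
n³≤[2048*C/8]² {a} {n} {C} 2≤a n< C≥ = begin
  n ^ 3                ≤⟨ ^-monoˡ-≤ 3 (<⇒≤ n<) ⟩
  (16 * a ^ 4) ^ 3     ≡⟨ solve 1 (λ a → (con 16 :* a :^ 4) :^ 3 := (con 64 :* a :^ 6) :^ 2) refl a ⟩
  (64 * a ^ 6) ^ 2     ≤⟨ ^-monoˡ-≤ 2 (*-monoʳ-≤ 64 a⁶≤32D) ⟩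
  (64 * (32 * D)) ^ 2  ≡⟨ cong (_^ 2) (*-assoc 64 32 D) ⟨
  (2048 * D) ^ 2       ∎
  where
  open ≤-Reasoning
  D = C / 8
  a⁶≤2C : a ^ 6 ≤ 2 * C
  a⁶≤2C = begin
    a ^ 6                           ≡⟨ solve 1 (λ a → a :^ 6 := a :^ 4 :* (a :* a)) refl a ⟩
    a ^ 4 * (a * a)                 ≤⟨ *-monoʳ-≤ (a ^ 4) (a*a≤2*[a*[a∸1]] 2≤a) ⟩
    a ^ 4 * (2 * (a * (a ∸ 1)))     ≡⟨ solve 2 (λ x y → x :* (con 2 :* y) := con 2 :* (x :* y)) refl (a ^ 4) (a * (a ∸ 1)) ⟩
    2 * (a ^ 4 * (a * (a ∸ 1)))     ≤⟨ *-monoʳ-≤ 2 C≥ ⟩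
    2 * C                           ∎
  a⁶<16[1+D] : a ^ 6 < 16 * suc D
  a⁶<16[1+D] = ≤-<-trans a⁶≤2C (subst (2 * C <_) (sym (*-assoc 2 8 (suc D))) (*-monoʳ-< 2 (m<8*[1+m/8] C)))
  1≤D : 1 ≤ D
  1≤D = s≤s⁻¹ (≤-trans (s≤s (s≤s z≤n)) (*-cancelˡ-< 16 4 (suc D) (≤-<-trans (^-monoˡ-≤ 6 2≤a) a⁶<16[1+D])))
  a⁶≤32D : a ^ 6 ≤ 32 * D
  a⁶≤32D = ≤-trans (<⇒≤ a⁶<16[1+D]) (begin
    16 * suc D       ≡⟨ *-suc 16 D ⟩
    16 + 16 * D      ≤⟨ +-monoˡ-≤ (16 * D) (*-monoʳ-≤ 16 1≤D) ⟩
    16 * D + 16 * D  ≡⟨ solve 1 (λ D → con 16 :* D :+ con 16 :* D := con 32 :* D) refl D ⟩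
    32 * D           ∎)

ManyC4s : ℕ → ℕ → Set
ManyC4s k n = Σ (Graph n) λ G → Σ (Colouring n) λ col → GoodColoured G col × (n ^ 3 ≤ (suc k * numC4 G) ^ 2)

manyC4s : ∀ {n} t a → 2 ≤ a → 2 ^ t ≡ a ^ 4 → 2 ^ t ≤ n → n < 16 * 2 ^ t → ManyC4s 2047 n
manyC4s {n} t a 2≤a 2^t≡a⁴ 2^t≤n n<16·2^t =
  let S , sidonSet , |S|≡a = greedySidonSet {t} a (subst (a ^ 3 <_) (sym 2^t≡a⁴) (^-monoʳ-< a 2≤a (n<1+n 3)))
      open CayleyGraph sidonSet 2^t≤n
  in G , colour , goodColoured ,
     n³≤[2048*C/8]² 2≤a (subst (λ m → n < 16 * m) 2^t≡a⁴ n<16·2^t)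
       (subst₂ (λ p m → p * (m * (m ∸ 1)) ≤ cycleTuples G) 2^t≡a⁴ |S|≡a cycleTuples≥)

proposition3p4 : ∃[ k ] ∃[ N ] ∀ (n : ℕ) → N ≤ n →
    Σ (Graph n) λ G → Σ (Colouring n) λ col →
      GoodColoured G col × (n ^ 3 ≤ (suc k * numC4 G) ^ 2)
proposition3p4 = 2047 , 16 , λ n 16≤n → witness n (b^q≤n<b^[1+q] 16 (s≤s (s≤s z≤n)) (≤-trans (s≤s z≤n) 16≤n)) 16≤n
  where
  witness : ∀ n → ∃[ q ] 16 ^ q ≤ n × n < 16 ^ suc q → 16 ≤ n → ManyC4s 2047 n
  witness n (zero , _ , n<16) 16≤n = contradiction 16≤n (<⇒≱ n<16)
  witness n (suc p , 16^q≤n , n<16^[1+q]) _ =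
    manyC4s (4 * suc p) (2 ^ suc p) (*-monoʳ-≤ 2 (m^n>0 2 p))
      (trans (cong (2 ^_) (*-comm 4 (suc p))) (sym (^-*-assoc 2 (suc p) 4)))
      (subst (_≤ n) (^-*-assoc 2 4 (suc p)) 16^q≤n)
      (subst (λ m → n < 16 * m) (^-*-assoc 2 4 (suc p)) n<16^[1+q])
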